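{- Let $\Gamma$ be the block graph of an orthogonal array $OA(n,m)$ with $n>(m-1)^2$. Then $\Gamma$ is $n$-clique regular and $C_n(\Gamma)$ is isomorphic to the complete $m$-partite graph in which each part has $n$ vertices.
   Context: An orthogonal array $OA(n,m)$ (with $m\ge2$) is an $n^2\times m$ array with entries from an $n$-element set such that in every $n^2\times 2$ subarray (choice of two columns) each of the $n^2$ ordered pairs of symbols occurs as a row exactly once. Its block graph has the rows of the array as vertices, two rows being adjacent iff they have the same entry in some column. A graph is $\omega$-clique regular if its edge set is nonempty and every edge lies in exactly one clique of order $\omega$ (set of $\omega$ pairwise adjacent vertices). $C_n(\Gamma)$ has the cliques of order $n$ of $\Gamma$ as vertices, two distinct cliques being adjacent iff they intersect. -}

module Defs where

open import Data.Nat using (ℕ; _*_)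
open import Data.Fin using (Fin)
open import Data.Fin.Subset using (Subset; _∈_; ∣_∣)
open import Data.Product using (Σ; ∃; ∃-syntax; _×_; _,_; proj₁)
open import Relation.Binary.PropositionalEquality using (_≡_; _≢_)
open import Function.Bundles using (_⇔_)
open import Function.Definitions using (Bijective)

Array : ℕ → ℕ → Set
Array n m = Fin (n * n) → Fin m → Fin n

-- Orthogonal array OA(n,m): for any two distinct columns c, d, every ordered
-- pair of symbols occurs exactly once as a row of the n²×2 subarray, i.e.
-- the map r ↦ (A r c , A r d) is a bijection Fin (n*n) → Fin n × Fin n.
IsOA : (n m : ℕ) → Array n m → Set
IsOA n m A = ∀ (c d : Fin m) → c ≢ d → Bijective _≡_ _≡_ (λ r → (A r c , A r d))

Graph : ℕ → Set₁
Graph N = Fin N → Fin N → Set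

BlockGraph : (n m : ℕ) → Array n m → Graph (n * n)
BlockGraph n m A r s = r ≢ s × ∃[ c ] A r c ≡ A s c

IsClique : {N : ℕ} → Graph N → ℕ → Subset N → Set
IsClique {N} G ω K = ∣ K ∣ ≡ ω × (∀ (x y : Fin N) → x ∈ K → y ∈ K → x ≢ y → G x y)

CliqueRegular : {N : ℕ} → Graph N → ℕ → Set
CliqueRegular {N} G ω =
  (∃[ x ] ∃[ y ] G x y) ×
  (∀ (x y : Fin N) → G x y →
     Σ (Subset N) λ K → (IsClique G ω K × x ∈ K × y ∈ K) ×
       (∀ (K' : Subset N) → IsClique G ω K' → x ∈ K' → y ∈ K' → K' ≡ K))

CAdj : {N : ℕ} → Subset N → Subset N → Set
CAdj {N} K L = K ≢ L × ∃[ x ] (x ∈ K × x ∈ L)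

MultipartiteAdj : (m n : ℕ) → (Fin m × Fin n) → (Fin m × Fin n) → Set
MultipartiteAdj m n p q = proj₁ p ≢ proj₁ q

-- C_ω(G) is isomorphic to the complete m-partite graph with parts of size n:
-- there is a bijection g from Fin m × Fin n onto the set of ω-cliques of G
-- (injective, lands in ω-cliques, hits every ω-clique) preserving and
-- reflecting adjacency.
CIsoMultipartite : {N : ℕ} → Graph N → ℕ → (m n : ℕ) → Set
CIsoMultipartite {N} G ω m n =
  Σ (Fin m × Fin n → Subset N) λ g →
    (∀ p → IsClique G ω (g p)) ×
    (∀ p q → g p ≡ g q → p ≡ q) ×
    (∀ K → IsClique G ω K → ∃[ p ] g p ≡ K) ×
    (∀ p q → CAdj (g p) (g q) ⇔ MultipartiteAdj m n p q)

{-# OPTIONS --safe #-}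
-- The rows carrying symbol a in column c form a clique L(c,a) of size n, a "line", and
-- lines in distinct columns meet in exactly one row. Conversely, let K be a clique and
-- x ∈ K such that K lies in no line through x: choose for every column c a row z_c ∈ K
-- differing from x in column c, and a column e_c in which x and z_c agree. Every other
-- y ∈ K agrees with x in some column c and with z_c in some column d; then d ∉ {c, e_c},
-- and (c, d) determines y since two rows agreeing in two columns are equal. Hence
-- |K| ≤ 1 + m(m − 2) = (m − 1)², so for n > (m − 1)² the n-cliques are exactly the mn
-- lines: an edge lies only in the line of the column it comes from, and two lines
-- intersect iff they belong to different columns.
module Submission where

open import Defs
open import Level using (Level)
open import Data.Nat using (ℕ; zero; suc; _+_; _*_; _∸_; _^_; _<_; _≤_; z≤n; s≤s)
open import Data.Nat.Properties using (≤-trans; ≤-antisym; ≤-reflexive; <⇒≱; ≤⇒≯; >⇒≢)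
open import Data.Nat.Tactic.RingSolver using (solve-∀)
open import Data.Fin using (Fin; zero; suc; punchIn; punchOut; combine; _≟_)
open import Data.Fin.Properties
  using (suc-injective; 0≢1+n; punchInᵢ≢i; punchOut-injective; combine-injective; any?; ¬∀⟶∃¬)
open import Data.Fin.Subset using (Subset; _∈_; _∉_; _⊆_; _⊈_; ∣_∣; ⊤; _-_; inside; outside; Nonempty)
open import Data.Fin.Subset.Properties
  using (_∈?_; _⊆?_; ∈⊤; ∣⊤∣≡n; ∣⊥∣≡0; ⊆-antisym; p⊂q⇒∣p∣<∣q∣; x∈p⇒∣p-x∣<∣p∣; x∈p∧x≢y⇒x∈p-y;
         nonempty?; Empty-unique)
open import Data.Vec using ([]; _∷_; tabulate; here; there)
open import Data.Vec.Properties using (lookup∘tabulate; []=⇒lookup; lookup⇒[]=)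
open import Data.Product using (Σ; ∃₂; ∃-syntax; _×_; _,_; proj₁; proj₂; uncurry)
open import Function using (_∘_; const)
open import Function.Bundles using (_⇔_; mk⇔)
open import Relation.Nullary using (Dec; yes; no; does; contradiction)
open import Relation.Nullary.Decidable using (dec-true; _→-dec_)
open import Relation.Unary using (Pred; Decidable)
open import Relation.Binary.PropositionalEquality
  using (_≡_; _≢_; refl; sym; trans; cong; cong₂; subst)

private
  variable
    ℓ : Level
    N M : ℕ

Complete : Graph N → Subset N → Set
Complete {N} G K = ∀ (x y : Fin N) → x ∈ K → y ∈ K → x ≢ y → G x y

injective⇒∣p∣≤∣q∣ : {p : Subset N} {q : Subset M} (f : ∀ x → x ∈ p → Fin M) →
                    (∀ x x∈p → f x x∈p ∈ q) →
                    (∀ x y x∈p y∈p → f x x∈p ≡ f y y∈p → x ≡ y) →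
                    ∣ p ∣ ≤ ∣ q ∣
injective⇒∣p∣≤∣q∣ {p = []} f f∈q f-inj = z≤n
injective⇒∣p∣≤∣q∣ {p = outside ∷ p} f f∈q f-inj =
  injective⇒∣p∣≤∣q∣ (λ x → f (suc x) ∘ there) (λ x → f∈q (suc x) ∘ there)
    (λ x y x∈p y∈p → suc-injective ∘ f-inj _ _ _ _)
injective⇒∣p∣≤∣q∣ {p = inside ∷ p} {q = q} f f∈q f-inj =
  ≤-trans (s≤s ∣p∣≤∣q-f₀∣) (x∈p⇒∣p-x∣<∣p∣ (f∈q zero here))
  where
  ∣p∣≤∣q-f₀∣ : ∣ p ∣ ≤ ∣ q - f zero here ∣
  ∣p∣≤∣q-f₀∣ = injective⇒∣p∣≤∣q∣ {q = q - f zero here} (λ x → f (suc x) ∘ there)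
    (λ x x∈p → x∈p∧x≢y⇒x∈p-y (f∈q (suc x) (there x∈p)) (0≢1+n ∘ sym ∘ f-inj _ _ _ _))
    (λ x y x∈p y∈p → suc-injective ∘ f-inj _ _ _ _)

p⊆q∧∣q∣≤∣p∣⇒p≡q : {p q : Subset N} → p ⊆ q → ∣ q ∣ ≤ ∣ p ∣ → p ≡ q
p⊆q∧∣q∣≤∣p∣⇒p≡q {p = p} {q} p⊆q ∣q∣≤∣p∣ = ⊆-antisym p⊆q q⊆p
  where
  q⊆p : q ⊆ p
  q⊆p {x} x∈q with x ∈? p
  ... | yes x∈p = x∈p
  ... | no x∉p = contradiction ∣q∣≤∣p∣ (<⇒≱ (p⊂q⇒∣p∣<∣q∣ (p⊆q , x , x∈q , x∉p)))

∣p∣>0⇒Nonempty : {p : Subset N} → 0 < ∣ p ∣ → Nonempty p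
∣p∣>0⇒Nonempty {N} {p} ∣p∣>0 with nonempty? p
... | yes p-nonempty = p-nonempty
... | no p-empty = contradiction (trans (cong ∣_∣ (Empty-unique p-empty)) (∣⊥∣≡0 N)) (>⇒≢ ∣p∣>0)

p⊈q⇒∃∈∖ : {p q : Subset N} → p ⊈ q → ∃[ x ] x ∈ p × x ∉ q
p⊈q⇒∃∈∖ {N} {p} {q} p⊈q with ¬∀⟶∃¬ N _ (λ x → x ∈? p →-dec x ∈? q) (λ p⊆q → p⊈q (p⊆q _))
... | x , x∈p↛q with x ∈? p
...   | yes x∈p = x , x∈p , x∈p↛q ∘ const
...   | no x∉p = contradiction (λ x∈p → contradiction x∈p x∉p) x∈p↛q

satisfying : {P : Pred (Fin N) ℓ} → Decidable P → Subset N
satisfying P? = tabulate (does ∘ P?)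

∈-satisfying⁺ : {P : Pred (Fin N) ℓ} (P? : Decidable P) {x : Fin N} → P x → x ∈ satisfying P?
∈-satisfying⁺ P? {x} Px = lookup⇒[]= x _ (trans (lookup∘tabulate _ x) (dec-true (P? x) Px))

∈-satisfying⁻ : {P : Pred (Fin N) ℓ} (P? : Decidable P) {x : Fin N} → x ∈ satisfying P? → P x
∈-satisfying⁻ P? {x} x∈ with P? x | trans (sym (lookup∘tabulate (does ∘ P?) x)) ([]=⇒lookup x∈)
... | yes Px | _ = Px
... | no _ | ()

punchOut₂ : {i j k : Fin (suc (suc N))} → i ≢ j → i ≢ k → j ≢ k → Fin N
punchOut₂ i≢j i≢k j≢k = punchOut (j≢k ∘ punchOut-injective i≢j i≢k)

punchOut₂-injective : {i j k l : Fin (suc (suc N))}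
                      (i≢j : i ≢ j) (i≢k : i ≢ k) (j≢k : j ≢ k) (i≢l : i ≢ l) (j≢l : j ≢ l) →
                      punchOut₂ i≢j i≢k j≢k ≡ punchOut₂ i≢j i≢l j≢l → k ≡ l
punchOut₂-injective i≢j i≢k j≢k i≢l j≢l =
  punchOut-injective i≢k i≢l ∘ punchOut-injective j′≢k′ j′≢l′
  where
  j′≢k′ : punchOut i≢j ≢ punchOut i≢k
  j′≢k′ = j≢k ∘ punchOut-injective i≢j i≢k
  j′≢l′ : punchOut i≢j ≢ punchOut i≢l
  j′≢l′ = j≢l ∘ punchOut-injective i≢j i≢l

1+[2+k]k≡[1+k]² : ∀ k → suc ((2 + k) * k) ≡ suc k ^ 2
1+[2+k]k≡[1+k]² = ring
  where
  ring : ∀ k → suc ((2 + k) * k) ≡ suc k * (suc k * 1)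
  ring = solve-∀

module OrthogonalArray {n k : ℕ} (A : Array n (2 + k)) (isOA : IsOA n (2 + k) A) where

  private
    m : ℕ
    m = 2 + k

    variable
      c d : Fin m
      a b b′ : Fin n
      x y : Fin (n * n)

  Γ : Graph (n * n)
  Γ = BlockGraph n m A

  agree-twice⇒≡ : c ≢ d → A x c ≡ A y c → A x d ≡ A y d → x ≡ y
  agree-twice⇒≡ {c} {d} c≢d x≈y₁ x≈y₂ = proj₁ (isOA c d c≢d) (cong₂ _,_ x≈y₁ x≈y₂)

  rowWith : c ≢ d → Fin n → Fin n → Fin (n * n)
  rowWith {c} {d} c≢d a b = proj₁ (proj₂ (isOA c d c≢d) (a , b))

  A-rowWithˡ : (c≢d : c ≢ d) → A (rowWith c≢d a b) c ≡ a
  A-rowWithˡ {c} {d} {a} {b} c≢d = cong proj₁ (proj₂ (proj₂ (isOA c d c≢d) (a , b)) refl)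

  A-rowWithʳ : (c≢d : c ≢ d) → A (rowWith c≢d a b) d ≡ b
  A-rowWithʳ {c} {d} {a} {b} c≢d = cong proj₂ (proj₂ (proj₂ (isOA c d c≢d) (a , b)) refl)

  rowWith-injectiveʳ : (c≢d : c ≢ d) → rowWith c≢d a b ≡ rowWith c≢d a b′ → b ≡ b′
  rowWith-injectiveʳ {d = d} c≢d eq =
    trans (sym (A-rowWithʳ c≢d)) (trans (cong (λ x → A x d) eq) (A-rowWithʳ c≢d))

  another : (c : Fin m) → Fin m
  another c = punchIn c zero

  c≢another : (c : Fin m) → c ≢ another c
  c≢another c = punchInᵢ≢i c zero ∘ sym

  line : Fin m → Fin n → Subset (n * n)
  line c a = satisfying (λ x → A x c ≟ a)

  ∈-line⁺ : A x c ≡ a → x ∈ line c a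
  ∈-line⁺ {c = c} {a} = ∈-satisfying⁺ (λ x → A x c ≟ a)

  ∈-line⁻ : x ∈ line c a → A x c ≡ a
  ∈-line⁻ {c = c} {a} = ∈-satisfying⁻ (λ x → A x c ≟ a)

  rowWith∈lineˡ : (c≢d : c ≢ d) → rowWith c≢d a b ∈ line c a
  rowWith∈lineˡ c≢d = ∈-line⁺ (A-rowWithˡ c≢d)

  rowWith∈lineʳ : (c≢d : c ≢ d) → rowWith c≢d a b ∈ line d b
  rowWith∈lineʳ c≢d = ∈-line⁺ (A-rowWithʳ c≢d)

  -- Reading off a second column is a bijection from the line onto the symbols.
  ∣line∣≡n : ∀ c a → ∣ line c a ∣ ≡ n
  ∣line∣≡n c a = ≤-antisym (subst (∣ line c a ∣ ≤_) (∣⊤∣≡n n) ∣line∣≤∣⊤∣)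
                           (subst (_≤ ∣ line c a ∣) (∣⊤∣≡n n) ∣⊤∣≤∣line∣)
    where
    c≢d : c ≢ another c
    c≢d = c≢another c
    ∣line∣≤∣⊤∣ : ∣ line c a ∣ ≤ ∣ ⊤ {n} ∣
    ∣line∣≤∣⊤∣ = injective⇒∣p∣≤∣q∣ (λ x _ → A x (another c)) (λ _ _ → ∈⊤)
      (λ x y x∈ y∈ → agree-twice⇒≡ c≢d (trans (∈-line⁻ x∈) (sym (∈-line⁻ y∈))))
    ∣⊤∣≤∣line∣ : ∣ ⊤ {n} ∣ ≤ ∣ line c a ∣
    ∣⊤∣≤∣line∣ = injective⇒∣p∣≤∣q∣ {p = ⊤} (λ b _ → rowWith c≢d a b) (λ _ _ → rowWith∈lineˡ c≢d)
      (λ _ _ _ _ → rowWith-injectiveʳ c≢d)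

  line-isClique : ∀ c a → IsClique Γ n (line c a)
  line-isClique c a =
    ∣line∣≡n c a , λ x y x∈ y∈ x≢y → x≢y , c , trans (∈-line⁻ x∈) (sym (∈-line⁻ y∈))

  lines-meeting-twice : x ≢ y → x ∈ line c a → y ∈ line c a → x ∈ line d b → y ∈ line d b →
                        c ≡ d × a ≡ b
  lines-meeting-twice {c = c} {d = d} x≢y x∈ca y∈ca x∈db y∈db with c ≟ d
  ... | yes refl = refl , trans (sym (∈-line⁻ x∈ca)) (∈-line⁻ x∈db)
  ... | no c≢d = contradiction (agree-twice⇒≡ c≢d (trans (∈-line⁻ x∈ca) (sym (∈-line⁻ y∈ca)))
                                                 (trans (∈-line⁻ x∈db) (sym (∈-line⁻ y∈db)))) x≢y

  module _ {K : Subset (n * n)} (K-complete : Complete Γ K) {x : Fin (n * n)} (x∈K : x ∈ K)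
           (K⊈lines : ∀ c → ∃[ z ] z ∈ K × A z c ≢ A x c) where

    private
      agreement : ∀ {u v} → u ∈ K → v ∈ K → u ≢ v → ∃[ c ] A u c ≡ A v c
      agreement u∈K v∈K u≢v = proj₂ (K-complete _ _ u∈K v∈K u≢v)

      z : Fin m → Fin (n * n)
      z c = proj₁ (K⊈lines c)

      z∈K : ∀ c → z c ∈ K
      z∈K c = proj₁ (proj₂ (K⊈lines c))

      z≉x : ∀ c → A (z c) c ≢ A x c
      z≉x c = proj₂ (proj₂ (K⊈lines c))

      x≢z : ∀ c → x ≢ z c
      x≢z c x≡z = z≉x c (cong (λ r → A r c) (sym x≡z))

      e : Fin m → Fin m
      e c = proj₁ (agreement x∈K (z∈K c) (x≢z c))

      x≈z-at-e : ∀ c → A x (e c) ≡ A (z c) (e c)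
      x≈z-at-e c = proj₂ (agreement x∈K (z∈K c) (x≢z c))

      c≢e : ∀ c → c ≢ e c
      c≢e c c≡ec = z≉x c (sym (subst (λ d → A x d ≡ A (z c) d) (sym c≡ec) (x≈z-at-e c)))

    record Signature (y : Fin (n * n)) : Set where
      constructor mkSignature
      field
        x-col z-col : Fin m
        y≈x : A y x-col ≡ A x x-col
        y≈z : A y z-col ≡ A (z x-col) z-col
        x-col≢z-col : x-col ≢ z-col
        e≢z-col : e x-col ≢ z-col

    signature : y ∈ K → y ≢ x → Signature y
    signature {y} y∈K y≢x = mkSignature cₓ c₂ y≈x y≈z cₓ≢c₂ e≢c₂
      where
      cₓ : Fin m
      cₓ = proj₁ (agreement y∈K x∈K y≢x)
      y≈x : A y cₓ ≡ A x cₓ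
      y≈x = proj₂ (agreement y∈K x∈K y≢x)
      y≢z : y ≢ z cₓ
      y≢z y≡z = z≉x cₓ (subst (λ r → A r cₓ ≡ A x cₓ) y≡z y≈x)
      c₂ : Fin m
      c₂ = proj₁ (agreement y∈K (z∈K cₓ) y≢z)
      y≈z : A y c₂ ≡ A (z cₓ) c₂
      y≈z = proj₂ (agreement y∈K (z∈K cₓ) y≢z)
      cₓ≢c₂ : cₓ ≢ c₂
      cₓ≢c₂ cₓ≡c₂ = z≉x cₓ (trans (sym (subst (λ d → A y d ≡ A (z cₓ) d) (sym cₓ≡c₂) y≈z)) y≈x)
      e≢c₂ : e cₓ ≢ c₂
      e≢c₂ e≡c₂ = y≢x (agree-twice⇒≡ cₓ≢c₂ y≈x
        (trans y≈z (sym (subst (λ d → A x d ≡ A (z cₓ) d) e≡c₂ (x≈z-at-e cₓ)))))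

    encode : Signature y → Fin (m * k)
    encode (mkSignature c d _ _ c≢d e≢d) = combine c (punchOut₂ (c≢e c) c≢d e≢d)

    encode-injective : ∀ {y y′} (σ : Signature y) (τ : Signature y′) → encode σ ≡ encode τ → y ≡ y′
    encode-injective (mkSignature c d y≈x y≈z c≢d e≢d) (mkSignature c′ d′ y′≈x y′≈z c′≢d′ e≢d′) eq
      with combine-injective c _ c′ _ eq
    ... | refl , eq′ with punchOut₂-injective (c≢e c) c≢d e≢d c′≢d′ e≢d′ eq′
    ...   | refl = agree-twice⇒≡ c≢d (trans y≈x (sym y′≈x)) (trans y≈z (sym y′≈z))

    index : ∀ y → y ∈ K → Dec (y ≡ x) → Fin (suc (m * k))
    index y y∈K (yes _) = zero
    index y y∈K (no y≢x) = suc (encode (signature y∈K y≢x))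

    index-injective : ∀ y y′ (y∈K : y ∈ K) (y′∈K : y′ ∈ K)
                      (y≟x : Dec (y ≡ x)) (y′≟x : Dec (y′ ≡ x)) →
                      index y y∈K y≟x ≡ index y′ y′∈K y′≟x → y ≡ y′
    index-injective y y′ y∈K y′∈K (yes y≡x) (yes y′≡x) _ = trans y≡x (sym y′≡x)
    index-injective y y′ y∈K y′∈K (no y≢x) (no y′≢x) eq =
      encode-injective (signature y∈K y≢x) (signature y′∈K y′≢x) (suc-injective eq)

    ∣K∣≤[m-1]² : ∣ K ∣ ≤ suc k ^ 2
    ∣K∣≤[m-1]² = subst (∣ K ∣ ≤_) (trans (∣⊤∣≡n _) (1+[2+k]k≡[1+k]² k))
      (injective⇒∣p∣≤∣q∣ (λ y y∈K → index y y∈K (y ≟ x)) (λ _ _ → ∈⊤)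
        (λ y y′ y∈K y′∈K → index-injective y y′ y∈K y′∈K (y ≟ x) (y′ ≟ x)))

  clique⇒line : suc k ^ 2 < n → {K : Subset (n * n)} → IsClique Γ n K → ∃[ p ] uncurry line p ≡ K
  clique⇒line n>[m-1]² {K} (∣K∣≡n , K-complete)
    with ∣p∣>0⇒Nonempty (subst (0 <_) (sym ∣K∣≡n) (≤-trans (s≤s z≤n) n>[m-1]²))
  ... | x , x∈K with any? (λ c → K ⊆? line c (A x c))
  ...   | yes (c , K⊆line) =
    (c , A x c) , sym (p⊆q∧∣q∣≤∣p∣⇒p≡q K⊆line (≤-reflexive (trans (∣line∣≡n c _) (sym ∣K∣≡n))))
  ...   | no K⊈lines = contradiction (subst (suc k ^ 2 <_) (sym ∣K∣≡n) n>[m-1]²)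
                                      (≤⇒≯ (∣K∣≤[m-1]² K-complete x∈K leaves))
    where
    leaves : ∀ c → ∃[ z ] z ∈ K × A z c ≢ A x c
    leaves c with p⊈q⇒∃∈∖ (λ K⊆line → K⊈lines (c , K⊆line))
    ... | z , z∈K , z∉line = z , z∈K , z∉line ∘ ∈-line⁺

  module _ {a₀ a₁ : Fin n} (a₀≢a₁ : a₀ ≢ a₁) where

    line-has-two-rows : ∀ c a → ∃₂ λ x y → x ≢ y × x ∈ line c a × y ∈ line c a
    line-has-two-rows c a =
      rowWith c≢d a a₀ , rowWith c≢d a a₁ , a₀≢a₁ ∘ rowWith-injectiveʳ c≢d ,
      rowWith∈lineˡ c≢d , rowWith∈lineˡ c≢d
      where
      c≢d : c ≢ another c
      c≢d = c≢another c

    line-injective : line c a ≡ line d b → (c , a) ≡ (d , b)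
    line-injective {c} {a} eq with line-has-two-rows c a
    ... | x , y , x≢y , x∈ , y∈
      with lines-meeting-twice x≢y x∈ y∈ (subst (x ∈_) eq x∈) (subst (y ∈_) eq y∈)
    ...   | refl , refl = refl

    CAdj-line⇔ : CAdj (line c a) (line d b) ⇔ c ≢ d
    CAdj-line⇔ {c} {a} {d} {b} = mk⇔ to from
      where
      to : CAdj (line c a) (line d b) → c ≢ d
      to (lines≢ , x , x∈ca , x∈db) c≡d =
        lines≢ (cong₂ line c≡d (trans (sym (∈-line⁻ x∈ca)) (trans (cong (A x) c≡d) (∈-line⁻ x∈db))))
      from : c ≢ d → CAdj (line c a) (line d b)
      from c≢d = (c≢d ∘ cong proj₁ ∘ line-injective) ,
                 rowWith c≢d a b , rowWith∈lineˡ c≢d , rowWith∈lineʳ c≢d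

    Γ-cliqueRegular : suc k ^ 2 < n → CliqueRegular Γ n
    Γ-cliqueRegular n>[m-1]² = edge , uniqueClique
      where
      edge : ∃[ x ] ∃[ y ] Γ x y
      edge with line-has-two-rows zero a₀
      ... | x , y , x≢y , x∈ , y∈ = x , y , proj₂ (line-isClique zero a₀) x y x∈ y∈ x≢y

      uniqueClique : ∀ x y → Γ x y →
        Σ (Subset (n * n)) λ K → (IsClique Γ n K × x ∈ K × y ∈ K) ×
          (∀ K′ → IsClique Γ n K′ → x ∈ K′ → y ∈ K′ → K′ ≡ K)
      uniqueClique x y (x≢y , c , x≈y) =
        line c (A x c) , (line-isClique c _ , ∈-line⁺ refl , ∈-line⁺ (sym x≈y)) , unique
        where
        unique : ∀ K′ → IsClique Γ n K′ → x ∈ K′ → y ∈ K′ → K′ ≡ line c (A x c)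
        unique K′ K′-clique x∈K′ y∈K′ with clique⇒line n>[m-1]² K′-clique
        ... | (c′ , a′) , refl
          with lines-meeting-twice x≢y x∈K′ y∈K′ (∈-line⁺ refl) (∈-line⁺ (sym x≈y))
        ...   | refl , refl = refl

    Cₙ[Γ]≅multipartite : suc k ^ 2 < n → CIsoMultipartite Γ n m n
    Cₙ[Γ]≅multipartite n>[m-1]² =
      uncurry line , uncurry line-isClique , (λ _ _ → line-injective) ,
      (λ _ → clique⇒line n>[m-1]²) , (λ _ _ → CAdj-line⇔)

corollary6p2 : (n m : ℕ) → 2 ≤ m → (m ∸ 1) ^ 2 < n → (A : Array n m) → IsOA n m A →
    CliqueRegular (BlockGraph n m A) n × CIsoMultipartite (BlockGraph n m A) n m n
-- n ≥ 2, so the symbols 0 and 1 are distinct.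
corollary6p2 n (suc (suc k)) (s≤s (s≤s z≤n)) n>[m-1]²@(s≤s (s≤s _)) A isOA =
  Γ-cliqueRegular 0≢1 n>[m-1]² , Cₙ[Γ]≅multipartite 0≢1 n>[m-1]²
  where
  open OrthogonalArray A isOA
  0≢1 : _≢_ {A = Fin n} zero (suc zero)
  0≢1 = 0≢1+n
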